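{- (Soundness) Every formula derivable in $\mathsf{Syn}^-$ is true at every world of every $\kappa$-model.
   Context: Fix a finite set $\mathsf{Ag}$ of agents; an agent pattern is a set $G\subseteq\mathcal{P}(\mathsf{Ag})\setminus\{\emptyset\}$. Formulas: $\varphi::= p\mid\neg\varphi\mid\varphi\wedge\varphi\mid [G]\varphi$ ($p$ in a countable set $\mathsf{Prop}$, $G$ an agent pattern); $\bot:=p\wedge\neg p$ for fixed $p$; $\mathsf{alive}(G):=\neg[G]\bot$. $\mathsf{Syn}^-$ has axioms: all propositional tautologies; (K) $[G](\varphi\to\psi)\to([G]\varphi\to[G]\psi)$; (B) $\varphi\to[G]\neg[G]\neg\varphi$; (4) $[G]\varphi\to[G][G]\varphi$; (T) $\mathsf{alive}(G)\to([G]\varphi\to\varphi)$; (NE) $\bigvee_{G}\mathsf{alive}(G)$ over all agent patterns; (Mono) $[G]\varphi\to[H]\varphi$ if $G\subseteq H$; (Equiv) $[G\cup\{B\}]\varphi\to[G]\varphi$ if some $A\in G$ has $B\subseteq A$ ($B\ne\emptyset$); (Union) $\mathsf{alive}(G)\wedge\mathsf{alive}(H)\to\mathsf{alive}(G\cup H)$; (Clo) $\mathsf{alive}(G)\to\mathsf{alive}(\{A\cup B\})$ for $A,B\in G$; rules modus ponens and $[G]$-necessitation (from $\varphi$ infer $[G]\varphi$). A pre-model $\mathcal{M}=(W,\sim,V)$ consists of a set $W$, a function assigning to each agent pattern $G$ a symmetric and transitive relation $\sim_G$ on $W$, and $V:W\to\mathcal{P}(\mathsf{Prop})$. Truth: $\mathcal{M},w\Vdash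 p$ iff $p\in V(w)$; Boolean clauses as usual; $\mathcal{M},w\Vdash[G]\varphi$ iff $\mathcal{M},v\Vdash\varphi$ for all $v$ with $w\sim_G v$. Let $\mathsf{alive}(G)_\mathcal{M}=\{w\mid w\sim_G w\}$. A $\kappa$-model is a pre-model such that for all agent patterns $G,H$: (K1) $\mathsf{alive}(G)_\mathcal{M}\cap\mathsf{alive}(H)_\mathcal{M}\subseteq\mathsf{alive}(G\cup H)_\mathcal{M}$; (K2) $\mathsf{alive}(G)_\mathcal{M}\subseteq\mathsf{alive}(\{A\cup B\})_\mathcal{M}$ for $A,B\in G$; (K3) $\sim_H\subseteq\sim_G$ if $G\subseteq H$; (K4) $\sim_G\subseteq\sim_{G\cup\{B\}}$ if some $A\in G$ has $\emptyset\ne B\subseteq A$; (NE) for every $w\in W$ there is an agent pattern $G$ with $w\sim_G w$. -}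

module Defs where

open import Data.Nat using (ℕ; zero; suc)
open import Data.Bool using (Bool; true; false; _∨_; _∧_; not)
open import Data.Unit using (⊤; tt)
open import Data.Product using (_×_; _,_; Σ; proj₁; proj₂)
open import Data.List using (List; []; _∷_; foldr; cartesianProductWith)
open import Data.Vec using (Vec; []; _∷_)
open import Data.Fin.Subset using (Subset; _⊆_; Nonempty) renaming (_∪_ to _∪ₛ_)
open import Relation.Binary.PropositionalEquality using (_≡_)
open import Relation.Nullary using (¬_)

-- Agents are Fin n; a coalition is a  Subset n  (stdlib: Vec Bool n).
-- Sets of coalitions are represented canonically as binary tries, so
-- that two agent patterns are equal iff they have the same members.

Trie : ℕ → Set
Trie zero    = Bool
Trie (suc n) = Trie n × Trie n   -- (coalitions without agent 0 , with agent 0)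

memT : ∀ {n} → Trie n → Subset n → Bool
memT {zero}  b       []          = b
memT {suc n} (f , t) (false ∷ A) = memT f A
memT {suc n} (f , t) (true  ∷ A) = memT t A

-- An agent pattern: a set of NONEMPTY coalitions.  Canonical encoding:
-- the empty coalition has no slot at all.
Pat : ℕ → Set
Pat zero    = ⊤
Pat (suc n) = Pat n × Trie n

memP : ∀ {n} → Pat n → Subset n → Bool
memP {zero}  _       []          = false
memP {suc n} (g , t) (false ∷ A) = memP g A
memP {suc n} (g , t) (true  ∷ A) = memT t A

_∈P_ : ∀ {n} → Subset n → Pat n → Set
A ∈P G = memP G A ≡ true

_⊆P_ : ∀ {n} → Pat n → Pat n → Set
G ⊆P H = ∀ A → A ∈P G → A ∈P H

orT : ∀ {n} → Trie n → Trie n → Trie n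
orT {zero}  a b = a ∨ b
orT {suc n} (a , b) (c , d) = orT a c , orT b d

_∪P_ : ∀ {n} → Pat n → Pat n → Pat n
_∪P_ {zero}  _ _ = tt
_∪P_ {suc n} (g , t) (h , u) = (g ∪P h) , orT t u

-- insertion of a coalition (inserting the empty coalition does nothing;
-- it is only used for nonempty coalitions)
insT : ∀ {n} → Trie n → Subset n → Trie n
insT {zero}  _       []          = true
insT {suc n} (f , t) (false ∷ A) = insT f A , t
insT {suc n} (f , t) (true  ∷ A) = f , insT t A

insP : ∀ {n} → Pat n → Subset n → Pat n
insP {zero}  _       []          = tt
insP {suc n} (g , t) (false ∷ A) = insP g A , t
insP {suc n} (g , t) (true  ∷ A) = g , insT t A

emptyT : ∀ {n} → Trie n
emptyT {zero}  = false
emptyT {suc n} = emptyT , emptyT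

emptyP : ∀ {n} → Pat n
emptyP {zero}  = tt
emptyP {suc n} = emptyP , emptyT

_⊕_ : ∀ {n} → Pat n → Subset n → Pat n
G ⊕ B = insP G B

⟦_⟧ : ∀ {n} → Subset n → Pat n
⟦ A ⟧ = insP emptyP A

allT : ∀ n → List (Trie n)
allT zero    = false ∷ true ∷ []
allT (suc n) = cartesianProductWith _,_ (allT n) (allT n)

allP : ∀ n → List (Pat n)
allP zero    = tt ∷ []
allP (suc n) = cartesianProductWith _,_ (allP n) (allT n)

data Form (n : ℕ) : Set where
  var  : ℕ → Form n
  ~_   : Form n → Form n
  _&_  : Form n → Form n → Form n
  [_]_ : Pat n → Form n → Form n

infixr 6 _&_
infixr 7 ~_ [_]_
infixr 4 _⇒_
infixr 5 _∨F_

_⇒_ : ∀ {n} → Form n → Form n → Form n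
φ ⇒ ψ = ~ (φ & ~ ψ)

_∨F_ : ∀ {n} → Form n → Form n → Form n
φ ∨F ψ = ~ (~ φ & ~ ψ)

⊥F : ∀ {n} → Form n
⊥F = var 0 & ~ var 0

alive : ∀ {n} → Pat n → Form n
alive G = ~ ([ G ] ⊥F)

⋁ : ∀ {n} → List (Form n) → Form n
⋁ = foldr _∨F_ ⊥F

mapL : ∀ {A B : Set} → (A → B) → List A → List B
mapL f []       = []
mapL f (x ∷ xs) = f x ∷ mapL f xs

-- Propositional tautologies: true under every Boolean valuation of the
-- atoms and of the (maximal) modal subformulas [G]ψ, treated as atoms.

evalB : ∀ {n} → (ℕ → Bool) → (Pat n → Form n → Bool) → Form n → Bool
evalB v b (var p)   = v p
evalB v b (~ φ)     = not (evalB v b φ)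
evalB v b (φ & ψ)   = evalB v b φ ∧ evalB v b ψ
evalB v b ([ G ] φ) = b G φ

Tautology : ∀ {n} → Form n → Set
Tautology φ = ∀ v b → evalB v b φ ≡ true

data Syn⁻ {n : ℕ} : Form n → Set where
  taut  : ∀ {φ} → Tautology φ → Syn⁻ φ
  axK   : ∀ G φ ψ → Syn⁻ (([ G ] (φ ⇒ ψ)) ⇒ (([ G ] φ) ⇒ ([ G ] ψ)))
  axB   : ∀ G φ → Syn⁻ (φ ⇒ [ G ] ~ ([ G ] ~ φ))
  ax4   : ∀ G φ → Syn⁻ (([ G ] φ) ⇒ [ G ] [ G ] φ)
  axT   : ∀ G φ → Syn⁻ (alive G ⇒ (([ G ] φ) ⇒ φ))
  axNE  : Syn⁻ (⋁ (mapL alive (allP n)))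
  mono  : ∀ G H φ → G ⊆P H → Syn⁻ (([ G ] φ) ⇒ [ H ] φ)
  equiv : ∀ G A B φ → A ∈P G → B ⊆ A → Nonempty B →
          Syn⁻ (([ G ⊕ B ] φ) ⇒ [ G ] φ)
  union : ∀ G H → Syn⁻ ((alive G & alive H) ⇒ alive (G ∪P H))
  clo   : ∀ G A B → A ∈P G → B ∈P G → Syn⁻ (alive G ⇒ alive ⟦ A ∪ₛ B ⟧)
  mp    : ∀ {φ ψ} → Syn⁻ (φ ⇒ ψ) → Syn⁻ φ → Syn⁻ ψ
  nec   : ∀ G {φ} → Syn⁻ φ → Syn⁻ ([ G ] φ)

record KModel (n : ℕ) : Set₁ where
  field
    W     : Set
    R     : Pat n → W → W → Set
    V     : W → ℕ → Bool
    R-sym   : ∀ G {w v} → R G w v → R G v w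
    R-trans : ∀ G {u v w} → R G u v → R G v w → R G u w
    K1 : ∀ G H w → R G w w → R H w w → R (G ∪P H) w w
    K2 : ∀ G A B w → A ∈P G → B ∈P G → R G w w → R ⟦ A ∪ₛ B ⟧ w w
    K3 : ∀ G H → G ⊆P H → ∀ w v → R H w v → R G w v
    K4 : ∀ G A B → A ∈P G → B ⊆ A → Nonempty B →
         ∀ w v → R G w v → R (G ⊕ B) w v
    NE : ∀ w → Σ (Pat n) (λ G → R G w w)

open KModel public

_,_⊩_ : ∀ {n} (M : KModel n) → W M → Form n → Set
M , w ⊩ var p     = V M w p ≡ true
M , w ⊩ (~ φ)     = ¬ (M , w ⊩ φ)
M , w ⊩ (φ & ψ)   = (M , w ⊩ φ) × (M , w ⊩ ψ)
M , w ⊩ ([ G ] φ) = ∀ v → R M G w v → M , v ⊩ φ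

{-# OPTIONS --safe #-}
-- In a κ-model, alive(G) holds at w exactly when w ∼_G w, so the frame conditions K1–K4 and
-- NE validate Union, Clo, Mono, Equiv and NE, while symmetry and transitivity of ∼_G
-- validate B and 4.  A tautology is forced everywhere because forcing at w is reflected by
-- the Boolean evaluation that gives each boxed formula its truth value at w; deciding that
-- truth value, like modus ponens for the encoded implication, uses excluded middle.
module Submission where

open import Defs
open import Axiom.ExcludedMiddle using (ExcludedMiddle)
open import Axiom.DoubleNegationElimination using (em⇒dne)
open import Level using (0ℓ)
open import Data.Nat using (ℕ; zero; suc)
open import Data.Bool using (Bool; true; false)
open import Data.Unit using (tt)
open import Data.Empty using (⊥-elim)
open import Data.Product using (_,_)
open import Data.List.Membership.Propositional using (_∈_)
open import Data.List.Membership.Propositional.Properties using (∈-cartesianProductWith⁺)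
open import Data.List.Relation.Unary.Any using (here; there)
open import Relation.Nullary using (does; proof)
open import Relation.Nullary.Reflects using (Reflects; ofʸ; ofⁿ; invert; ¬-reflects; _×-reflects_)
open import Relation.Binary.PropositionalEquality using (_≡_; refl; subst)

∈-allT : ∀ n (t : Trie n) → t ∈ allT n
∈-allT zero    false   = here refl
∈-allT zero    true    = there (here refl)
∈-allT (suc n) (a , b) = ∈-cartesianProductWith⁺ _,_ (∈-allT n a) (∈-allT n b)

∈-allP : ∀ n (G : Pat n) → G ∈ allP n
∈-allP zero    tt      = here refl
∈-allP (suc n) (G , t) = ∈-cartesianProductWith⁺ _,_ (∈-allP n G) (∈-allT n t)

∈-mapL⁺ : ∀ {A B : Set} (f : A → B) {x xs} → x ∈ xs → f x ∈ mapL f xs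
∈-mapL⁺ f (here refl) = here refl
∈-mapL⁺ f (there x∈xs) = there (∈-mapL⁺ f x∈xs)

≡true-reflects : ∀ b → Reflects (b ≡ true) b
≡true-reflects true  = ofʸ refl
≡true-reflects false = ofⁿ λ ()

module Forcing {n : ℕ} (M : KModel n) where

  ⊩-⋁⁺ : ∀ {w φ φs} → φ ∈ φs → M , w ⊩ φ → M , w ⊩ ⋁ φs
  ⊩-⋁⁺ (here refl) p (¬p , _)   = ¬p p
  ⊩-⋁⁺ (there φ∈φs) p (_ , ¬ps) = ¬ps (⊩-⋁⁺ φ∈φs p)

  reflexive⇒alive : ∀ G {w} → R M G w w → M , w ⊩ alive G
  reflexive⇒alive G {w} r □⊥ = let (p , ¬p) = □⊥ w r in ¬p p

module ClassicalForcing (em : ExcludedMiddle 0ℓ) {n : ℕ} (M : KModel n) where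

  open Forcing M

  ⇒-elim : ∀ {w φ ψ} → M , w ⊩ (φ ⇒ ψ) → M , w ⊩ φ → M , w ⊩ ψ
  ⇒-elim φ⇒ψ p = em⇒dne em λ ¬q → φ⇒ψ (p , ¬q)

  -- Any successor v of w gives w ∼ v ∼ w, so a dead world has no successors at all.
  alive⇒reflexive : ∀ G {w} → M , w ⊩ alive G → R M G w w
  alive⇒reflexive G alive-w = em⇒dne em λ ¬r →
    alive-w λ v r → ⊥-elim (¬r (R-trans M G r (R-sym M G r)))

  boxTruth : W M → Pat n → Form n → Bool
  boxTruth w G φ = does (em {M , w ⊩ ([ G ] φ)})

  evalB-reflects-⊩ : ∀ w φ → Reflects (M , w ⊩ φ) (evalB (V M w) (boxTruth w) φ)
  evalB-reflects-⊩ w (var p)   = ≡true-reflects (V M w p)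
  evalB-reflects-⊩ w (~ φ)     = ¬-reflects (evalB-reflects-⊩ w φ)
  evalB-reflects-⊩ w (φ & ψ)   = evalB-reflects-⊩ w φ ×-reflects evalB-reflects-⊩ w ψ
  evalB-reflects-⊩ w ([ G ] φ) = proof em

  tautology-valid : ∀ {φ} → Tautology φ → ∀ w → M , w ⊩ φ
  tautology-valid {φ} t w =
    invert (subst (Reflects _) (t (V M w) (boxTruth w)) (evalB-reflects-⊩ w φ))

  -- φ ⇒ ψ unfolds to ¬ (φ & ~ ψ), so an implication is proved by refuting a pair (φ , ¬ ψ).
  soundness : ∀ {φ} → Syn⁻ φ → ∀ w → M , w ⊩ φ
  soundness (taut t) w = tautology-valid t w
  soundness (axK G φ ψ) w (□φ⇒ψ , ¬[□φ⇒□ψ]) = ¬[□φ⇒□ψ] λ (□φ , ¬□ψ) →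
    ¬□ψ λ v r → ⇒-elim (□φ⇒ψ v r) (□φ v r)
  soundness (axB G φ) w (p , ¬□◇φ) = ¬□◇φ λ v r □¬φ → □¬φ w (R-sym M G r) p
  soundness (ax4 G φ) w (□φ , ¬□□φ) = ¬□□φ λ v r u r′ → □φ u (R-trans M G r r′)
  soundness (axT G φ) w (alive-G , ¬[□φ⇒φ]) = ¬[□φ⇒φ] λ (□φ , ¬p) →
    ¬p (□φ w (alive⇒reflexive G alive-G))
  soundness axNE w = let (G , r) = NE M w in
    ⊩-⋁⁺ (∈-mapL⁺ alive (∈-allP n G)) (reflexive⇒alive G r)
  soundness (mono G H φ G⊆H) w (□φ , ¬□φ) = ¬□φ λ v r → □φ v (K3 M G H G⊆H w v r)
  soundness (equiv G A B φ A∈G B⊆A B≢∅) w (□φ , ¬□φ) =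
    ¬□φ λ v r → □φ v (K4 M G A B A∈G B⊆A B≢∅ w v r)
  soundness (union G H) w ((alive-G , alive-H) , ¬alive-G∪H) = ¬alive-G∪H (reflexive⇒alive (G ∪P H)
    (K1 M G H w (alive⇒reflexive G alive-G) (alive⇒reflexive H alive-H)))
  soundness (clo G A B A∈G B∈G) w (alive-G , ¬alive-A∪B) = ¬alive-A∪B
    (reflexive⇒alive _ (K2 M G A B w A∈G B∈G (alive⇒reflexive G alive-G)))
  soundness (mp ⊢φ⇒ψ ⊢φ) w = ⇒-elim (soundness ⊢φ⇒ψ w) (soundness ⊢φ w)
  soundness (nec G ⊢φ) w v r = soundness ⊢φ v

theorem5p10 : ExcludedMiddle 0ℓ → ∀ n (φ : Form n) → Syn⁻ φ →
                ∀ (M : KModel n) (w : W M) → M , w ⊩ φ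
theorem5p10 em n φ ⊢φ M = ClassicalForcing.soundness em M ⊢φ
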